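{- Let $\mathfrak{M}\subseteq \mathit{Mod}(\mathcal{L}_\leq)$ be a class of preference models, $\star: \mathit{Mod}(\mathcal{L}_\leq)\times \mathcal{L}_0 \rightarrow \mathit{Mod}(\mathcal{L}_\leq)$ be a $\mathfrak{M}$-DP3-compliant dynamic operator, and $\mathfrak{D} = \langle \mathfrak{M}, \star\rangle$. For any propositional formula $\varphi \in \mathcal{L}_0$ and dynamic preference formula $\xi \in \mathcal{L}_\leq(\star)$, it holds that $$\mathfrak{D}\vDash B(\varphi~|~[\star \varphi]\xi) \rightarrow [\star \varphi]B(\varphi ~|~\xi)$$
   Context: Fix a set $P$ of propositional letters; $\mathcal{L}_0$ is the classical propositional language over $P$. A (well-founded) preference model is $M=\langle W,\leq,v\rangle$ with $W$ a set of worlds, $\leq$ a reflexive, transitive relation on $W$ whose strict part $<$ is well-founded, and $v:P\to 2^W$ a valuation; $\mathit{Mod}(\mathcal{L}_\leq)$ is the class of all such models. A dynamic operator is a map $\star:\mathit{Mod}(\mathcal{L}_\leq)\times\mathcal{L}_0\to\mathit{Mod}(\mathcal{L}_\leq)$ with $\star(M,\varphi)=\langle W,\leq_{\star\varphi},v\rangle$ (same worlds and valuation). The language $\mathcal{L}_\leq(\star)$ is built from $P$ with $\neg,\wedge$, the universal modality $A$, the modalities $[\leq]$, $[<]$ (dual $\langle<\rangle$), and formulas $[\star\varphi]\xi$ with $\varphi\in\mathcal{L}_0$. A dynamic model is $D=\langle M,\star\rangle$, with standard clauses for $A,[\leq],[<]$ and $D,w\vDash[\star\varphi]\xi$ iff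 $\langle\star(M,\varphi),\star\rangle,w\vDash\xi$. For $\mathfrak{M}$ over which $\star$ is closed, $\mathfrak{D}=\langle\mathfrak{M},\star\rangle$ is the class of dynamic models $\langle M,\star\rangle$ with $M\in\mathfrak{M}$; validity in $\mathfrak{D}$ means truth at every world of every such model. $[\![\varphi]\!]$ denotes the set of worlds satisfying $\varphi$. $\mu\varphi:=\varphi\wedge\neg\langle<\rangle\varphi$ and the conditional belief $B(\psi\mid\varphi):=A(\mu\varphi\to\psi)$ (the most preferred $\varphi$-worlds satisfy $\psi$). $\star$ is $\mathfrak{M}$-DP3-compliant if for every $M=\langle W,\leq,v\rangle\in\mathfrak{M}$, every $\varphi\in\mathcal{L}_0$ and all $w,w'\in W$, with $D=\langle M,\star\rangle$: (DP3a) if $w\in[\![\varphi]\!]$, $w'\notin[\![\varphi]\!]$ and $w<w'$, then for every $\xi\in\mathcal{L}_\leq(\star)$ with $D,w\vDash[\star\varphi]\xi$ there is $w''\in[\![\varphi]\!]$ with $D,w''\vDash[\star\varphi]\xi$ and $w''<_{\star\varphi}w'$. -}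

module Defs where

open import Data.Product using (_×_; Σ-syntax; _,_)
open import Relation.Nullary using (¬_)
open import Induction.WellFounded using (WellFounded)

data L₀ (P : Set) : Set where
  atom : P → L₀ P
  neg  : L₀ P → L₀ P
  conj : L₀ P → L₀ P → L₀ P

record PrefOrder (W : Set) : Set₁ where
  field
    _≤_   : W → W → Set
    refl≤  : ∀ w → w ≤ w
    trans≤ : ∀ {u w w'} → u ≤ w → w ≤ w' → u ≤ w'
  _<_ : W → W → Set
  w < w' = (w ≤ w') × ¬ (w' ≤ w)
  field
    wf< : WellFounded _<_

record Model (P : Set) : Set₁ where
  field
    W   : Set
    ord : PrefOrder W
    v   : P → W → Set
  open PrefOrder ord public

open Model public

-- A dynamic operator ⋆ : Mod × L₀ → Mod keeping worlds and valuation: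
-- it only supplies a new well-founded preference order on the same worlds.
DynOp : Set → Set₁
DynOp P = (M : Model P) → L₀ P → PrefOrder (W M)

update : {P : Set} → DynOp P → Model P → L₀ P → Model P
update ⋆ M φ = record { W = W M ; ord = ⋆ M φ ; v = v M }

data Form (P : Set) : Set where
  atom  : P → Form P
  neg   : Form P → Form P
  conj  : Form P → Form P → Form P
  A     : Form P → Form P
  box≤  : Form P → Form P
  box<  : Form P → Form P
  dyn   : L₀ P → Form P → Form P

emb : {P : Set} → L₀ P → Form P
emb (atom p)   = atom p
emb (neg φ)    = neg (emb φ)
emb (conj φ ψ) = conj (emb φ) (emb ψ)

_⇒_ : {P : Set} → Form P → Form P → Form P
φ ⇒ ψ = neg (conj φ (neg ψ))

dia< : {P : Set} → Form P → Form P
dia< φ = neg (box< (neg φ))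

μ : {P : Set} → Form P → Form P
μ φ = conj φ (neg (dia< φ))

B : {P : Set} → Form P → Form P → Form P
B ψ φ = A (μ φ ⇒ ψ)

sat : {P : Set} → DynOp P → (M : Model P) → W M → Form P → Set
sat ⋆ M w (atom p)   = v M p w
sat ⋆ M w (neg ξ)    = ¬ sat ⋆ M w ξ
sat ⋆ M w (conj ξ χ) = sat ⋆ M w ξ × sat ⋆ M w χ
sat ⋆ M w (A ξ)      = ∀ w' → sat ⋆ M w' ξ
sat ⋆ M w (box≤ ξ)   = ∀ w' → _≤_ M w' w → sat ⋆ M w' ξ
sat ⋆ M w (box< ξ)   = ∀ w' → _<_ M w' w → sat ⋆ M w' ξ
sat ⋆ M w (dyn φ ξ)  = sat ⋆ (update ⋆ M φ) w ξ

⟦_⟧ : {P : Set} → L₀ P → (M : Model P) → W M → Set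
⟦ atom p ⟧   M w = v M p w
⟦ neg φ ⟧    M w = ¬ ⟦ φ ⟧ M w
⟦ conj φ ψ ⟧ M w = ⟦ φ ⟧ M w × ⟦ ψ ⟧ M w

ModelClass : Set → Set₂
ModelClass P = Model P → Set₁

ClosedUnder : {P : Set} → ModelClass P → DynOp P → Set₁
ClosedUnder 𝔐 ⋆ = ∀ M φ → 𝔐 M → 𝔐 (update ⋆ M φ)

Valid : {P : Set} → ModelClass P → DynOp P → Form P → Set₁
Valid 𝔐 ⋆ ξ = ∀ M → 𝔐 M → ∀ w → sat ⋆ M w ξ

DP3a : {P : Set} → ModelClass P → DynOp P → Set₁
DP3a {P} 𝔐 ⋆ =
  ∀ M → 𝔐 M → (φ : L₀ P) → (w w' : W M) →
  ⟦ φ ⟧ M w → ¬ ⟦ φ ⟧ M w' → _<_ M w w' →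
  (ξ : Form P) → sat ⋆ M w (dyn φ ξ) →
  Σ[ w'' ∈ W M ] (⟦ φ ⟧ M w'' × sat ⋆ M w'' (dyn φ ξ)
                   × PrefOrder._<_ (⋆ M φ) w'' w')

-- Suppose every most plausible [⋆φ]ξ-world satisfies φ, and let u be a most
-- plausible ξ-world after revising by φ. If u were a ¬φ-world, DP3a would
-- forbid any φ-world satisfying [⋆φ]ξ strictly below u (it would be lifted
-- strictly below u by the revision, against the minimality of u). By
-- well-founded induction, no [⋆φ]ξ-world lies below u at all: a lowest one
-- would be a most plausible [⋆φ]ξ-world, hence a φ-world. So u itself is a
-- most plausible [⋆φ]ξ-world, hence satisfies φ after all.
module Submission where

open import Defs hiding (_≤_; _<_; refl≤; trans≤; wf<)
open import Data.Product using (_×_; _,_)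
open import Function using (id)
open import Relation.Nullary using (¬_)
open import Relation.Binary.PropositionalEquality using (_≡_; refl; sym; cong; cong₂; trans; subst)
open import Induction.WellFounded using (Acc; acc)

module _ {W : Set} (O : PrefOrder W) where
  open PrefOrder O

  <-trans : ∀ {u w w'} → u < w → w < w' → u < w'
  <-trans (u≤w , w≰u) (w≤w' , w'≰w) = trans≤ u≤w w≤w' , λ w'≤u → w'≰w (trans≤ w'≤u u≤w)

  -- The constructive reading of μ: sat ⋆ M w (μ χ) unfolds to this.
  Minimal : (W → Set) → W → Set
  Minimal D x = D x × ¬ ¬ (∀ y → y < x → ¬ D y)

  minimal-of-nothing-below : ∀ {D u} → D u → (∀ x → x < u → ¬ D x) → Minimal D u
  minimal-of-nothing-below Du nothing-below = Du , λ ¬nothing-below → ¬nothing-below nothing-below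

  nothing-below-of-minimal-Φ : ∀ {D Φ : W → Set} {u} →
    (∀ x → ¬ (Minimal D x × ¬ Φ x)) → (∀ x → x < u → Φ x → ¬ D x) →
    ∀ x → x < u → ¬ D x
  nothing-below-of-minimal-Φ {D} {u = u} minimal-Φ no-ΦD-below x = go x (wf< x)
    where
    go : ∀ x → Acc _<_ x → x < u → ¬ D x
    go x (acc rs) x<u Dx =
      minimal-Φ x ((Dx , λ ¬nothing-below → ¬nothing-below λ y y<x → go y (rs y<x) (<-trans y<x x<u))
                  , λ Φx → no-ΦD-below x x<u Φx Dx)

module _ {P : Set} (⋆ : DynOp P) where

  sat-emb : (M : Model P) (ψ : L₀ P) (u : W M) → sat ⋆ M u (emb ψ) ≡ ⟦ ψ ⟧ M u
  sat-emb M (atom p)   u = refl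
  sat-emb M (neg ψ)    u = cong ¬_ (sat-emb M ψ u)
  sat-emb M (conj ψ χ) u = cong₂ _×_ (sat-emb M ψ u) (sat-emb M χ u)

  ⟦⟧-update : (M : Model P) (χ ψ : L₀ P) (u : W M) → ⟦ ψ ⟧ (update ⋆ M χ) u ≡ ⟦ ψ ⟧ M u
  ⟦⟧-update M χ (atom p)    u = refl
  ⟦⟧-update M χ (neg ψ)     u = cong ¬_ (⟦⟧-update M χ ψ u)
  ⟦⟧-update M χ (conj ψ ψ') u = cong₂ _×_ (⟦⟧-update M χ ψ u) (⟦⟧-update M χ ψ' u)

  sat-emb-update : (M : Model P) (χ ψ : L₀ P) (u : W M) →
                   sat ⋆ (update ⋆ M χ) u (emb ψ) ≡ ⟦ ψ ⟧ M u
  sat-emb-update M χ ψ u = trans (sat-emb (update ⋆ M χ) ψ u) (⟦⟧-update M χ ψ u)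

  DP3a⇒no-φ-below-revised-minimal : ∀ {𝔐} → DP3a 𝔐 ⋆ → ∀ {M} → 𝔐 M → (φ : L₀ P) (ξ : Form P) →
    ∀ {u} → ¬ ⟦ φ ⟧ M u → Minimal (⋆ M φ) (λ y → sat ⋆ (update ⋆ M φ) y ξ) u →
    ∀ x → Model._<_ M x u → ⟦ φ ⟧ M x → ¬ sat ⋆ M x (dyn φ ξ)
  DP3a⇒no-φ-below-revised-minimal dp3a M∈𝔐 φ ξ {u} ¬φu (_ , ¬ξ-below) x x<u φx ξx
    with dp3a _ M∈𝔐 φ x u φx ¬φu x<u ξ ξx
  ... | w'' , _ , ξw'' , w''<u = ¬ξ-below λ nothing-below → nothing-below w'' w''<u ξw''

fact34 : {P : Set} (𝔐 : ModelClass P) (⋆ : DynOp P) →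
         ClosedUnder 𝔐 ⋆ → DP3a 𝔐 ⋆ →
         (φ : L₀ P) (ξ : Form P) →
         Valid 𝔐 ⋆ (B (emb φ) (dyn φ ξ) ⇒ dyn φ (B (emb φ) ξ))
fact34 𝔐 ⋆ _ dp3a φ ξ M M∈𝔐 w (belief , ¬revised-belief) = ¬revised-belief revised-belief
  where
  belief-in-φ : ∀ x → ¬ (Minimal (ord M) (λ y → sat ⋆ M y (dyn φ ξ)) x × ¬ ⟦ φ ⟧ M x)
  belief-in-φ x (minimal , ¬φx) = belief x (minimal , λ φx → ¬φx (subst id (sat-emb ⋆ M φ x) φx))

  revised-belief : ∀ u → ¬ (sat ⋆ (update ⋆ M φ) u (μ ξ) × ¬ sat ⋆ (update ⋆ M φ) u (emb φ))
  revised-belief u (revised-minimal@(ξu , _) , ¬φu′) =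
    belief-in-φ u (minimal-of-nothing-below (ord M) ξu nothing-below , ¬φu)
    where
    ¬φu : ¬ ⟦ φ ⟧ M u
    ¬φu φu = ¬φu′ (subst id (sym (sat-emb-update ⋆ M φ φ u)) φu)

    nothing-below : ∀ x → Model._<_ M x u → ¬ sat ⋆ M x (dyn φ ξ)
    nothing-below = nothing-below-of-minimal-Φ (ord M) belief-in-φ
      (DP3a⇒no-φ-below-revised-minimal ⋆ dp3a M∈𝔐 φ ξ ¬φu revised-minimal)
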